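{- Let $s\ge 2$, $m\ge 1$ and $1\le l\le s$ be integers, $n=sm+s-l$, and let $\mathcal F\subset 2^{[n]}$ satisfy $\nu(\mathcal F)<s$. Then for every integer $u$ with $1\le u\le s-l$, $$y(m+u)\ge \frac1s\binom{n}{m+u}\sum_{i=1}^{\lfloor (s-l)/u\rfloor}X_i(\pi_e).$$
   Context: Members $F_1,\dots,F_s$ of $\mathcal F$ are pairwise disjoint if $F_i\cap F_j=\emptyset$ for $i\neq j$ (they may coincide only if empty); $\nu(\mathcal F)$ is the maximum number of pairwise disjoint members. Let $\bar{\mathcal F}=2^{[n]}\setminus\mathcal F$ and $y(q)=|\bar{\mathcal F}\cap\binom{[n]}{q}|$, the number of $q$-element subsets of $[n]$ not in $\mathcal F$. Let $N_e=\frac{n!}{(n-sm)!\,(m!)^s}$ be the number of ordered $s$-tuples $(A_1,\dots,A_s)$ of pairwise disjoint $m$-element subsets of $[n]$ (not necessarily covering $[n]$). For $0\le i\le s$, $X_i(\pi_e)$ is the number of such $s$-tuples for which exactly $i$ of the sets $A_r$ belong to $\bar{\mathcal F}$, divided by $N_e$. -}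

module Defs where

open import Data.Bool using (Bool; true; false; _∧_; not)
open import Data.Nat using (ℕ; zero; suc; _+_; _≡ᵇ_)
open import Data.List using (List; []; _∷_; map; concatMap; length; filterᵇ; applyUpTo)
open import Data.Nat.ListAction using (sum)
open import Data.Vec using (Vec; []; _∷_; zipWith; foldr′)
open import Data.Fin using (Fin)
open import Data.Fin.Subset using (Subset; _∈_; ∣_∣)
open import Data.Product using (_×_)
open import Relation.Nullary using (¬_)

Family : ℕ → Set
Family n = Subset n → Bool

Disjoint : {n : ℕ} → Subset n → Subset n → Set
Disjoint {n} A B = (k : Fin n) → ¬ (k ∈ A × k ∈ B)

disjᵇ : {n : ℕ} → Subset n → Subset n → Bool
disjᵇ A B = foldr′ _∧_ true (zipWith (λ a b → not (a ∧ b)) A B)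

allSubsets : (n : ℕ) → List (Subset n)
allSubsets zero = [] ∷ []
allSubsets (suc n) = concatMap (λ A → (false ∷ A) ∷ (true ∷ A) ∷ []) (allSubsets n)

allTuples : {A : Set} (s : ℕ) → List A → List (Vec A s)
allTuples zero xs = [] ∷ []
allTuples (suc s) xs = concatMap (λ x → map (x ∷_) (allTuples s xs)) xs

allᵇ : {A : Set} {k : ℕ} → (A → Bool) → Vec A k → Bool
allᵇ p v = foldr′ (λ a b → p a ∧ b) true v

pairwiseDisjᵇ : {n k : ℕ} → Vec (Subset n) k → Bool
pairwiseDisjᵇ [] = true
pairwiseDisjᵇ (A ∷ As) = allᵇ (disjᵇ A) As ∧ pairwiseDisjᵇ As

countᵇ : {A : Set} {k : ℕ} → (A → Bool) → Vec A k → ℕ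
countᵇ p v = foldr′ (λ a c → if′ p a then suc c else c) 0 v
  where
  if′_then_else_ : Bool → ℕ → ℕ → ℕ
  if′ true then x else y = x
  if′ false then x else y = y

y : {n : ℕ} → Family n → ℕ → ℕ
y {n} F q = length (filterᵇ (λ A → (∣ A ∣ ≡ᵇ q) ∧ not (F A)) (allSubsets n))

-- number of ordered s-tuples (A_1,…,A_s) of pairwise disjoint m-element subsets
-- of [n] with exactly i of the A_r in the complement of 𝓕.
-- (X_i(π_e) = cntX F s m i / N_e.)
cntX : {n : ℕ} → Family n → (s m i : ℕ) → ℕ
cntX {n} F s m i =
  length (filterᵇ
    (λ As → allᵇ (λ A → ∣ A ∣ ≡ᵇ m) As ∧ pairwiseDisjᵇ As
            ∧ (countᵇ (λ A → not (F A)) As ≡ᵇ i))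
    (allTuples s (allSubsets n)))

Σ₁ : ℕ → (ℕ → ℕ) → ℕ
Σ₁ k f = sum (applyUpTo (λ i → f (suc i)) k)

-- Proof by double counting.  Fix such a tuple T with 1 ≤ i ≤ t/u and let Y be its t uncovered
-- points.  Since ν(𝓕) < s, T cannot be completed to s disjoint members of 𝓕 by enlarging its
-- entries with disjoint parts of Y (packing-blocked).  The key claim then shows, by induction on
-- T, that the pairs (r, B) with B a u-subset of Y and T_r ∪ B ∉ 𝓕 number at least C(t, u).
-- Conversely each such pair yields an (m+u)-set T_r ∪ B outside 𝓕 trapping T_r, and a fixed
-- (m+u)-set traps the r-th entry of at most C(m+u, m) · arrangements(n−m−u, s−1) tuples
-- (escape-count).  This gives Σ cntX(i) · C(t,u) ≤ s · y(m+u) · C(m+u,m) · arrangements(...)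
-- (escape-inequality), and the factorial identities choose-then-arrange and
-- arrangements-factorial turn this into the stated inequality (clear-denominators).

module Submission where

open import Defs
open import Data.Bool using (Bool; true; false; _∧_; _∨_; not; T)
open import Data.Bool.Properties using (∧-zeroʳ; ∧-assoc)
open import Data.Nat using (ℕ; zero; suc; NonZero; _+_; _*_; _∸_; _^_; _!; _≤_; _≥_; _≡ᵇ_; s≤s; z≤n; >-nonZero)
open import Data.Nat.Properties
open import Data.Nat.ListAction using (sum)
open import Data.Nat.Combinatorics using (_C_; nCk≡n!/k![n-k]!; k![n∸k]!∣n!; nCk+nC[k+1]≡[n+1]C[k+1])
open import Data.Nat.DivMod using (_/_; m/n*n≡m; m/n*n≤m)
open import Data.List using (List; []; _∷_; _++_; map; concatMap; filterᵇ; length; applyUpTo; allFin; tabulate)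
open import Data.Vec using (Vec; []; _∷_; lookup; there)
open import Data.Fin using (Fin; zero; suc)
open import Data.Fin.Subset using (Subset; ∣_∣; _∪_; _─_) renaming (⊤ to full)
open import Data.Fin.Subset.Properties using (∣⊤∣≡n)
open import Data.Product using (Σ; _×_; _,_; proj₁; proj₂)
open import Data.Empty using (⊥; ⊥-elim)
open import Function using (_∘_)
open import Relation.Nullary using (¬_)
open import Relation.Binary.PropositionalEquality
open import Data.Nat.Tactic.RingSolver using (solve-∀)
open import Algebra.Properties.CommutativeSemigroup +-commutativeSemigroup
  using () renaming (interchange to +-interchange)
open import Algebra.Properties.CommutativeSemigroup *-commutativeSemigroup
  using () renaming (x∙yz≈y∙xz to *-left-swap)

private
  variable
    A B : Set
    n k : ℕ

𝟙 : Bool → ℕ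
𝟙 true = 1
𝟙 false = 0

∑ : List A → (A → ℕ) → ℕ
∑ [] f = 0
∑ (x ∷ xs) f = f x + ∑ xs f

syntax ∑ xs (λ x → e) = ∑[ x ← xs ] e

count : (A → Bool) → List A → ℕ
count p xs = ∑[ x ← xs ] 𝟙 (p x)

length-filterᵇ : (p : A → Bool) (xs : List A) → length (filterᵇ p xs) ≡ count p xs
length-filterᵇ p [] = refl
length-filterᵇ p (x ∷ xs) with p x
... | true = cong suc (length-filterᵇ p xs)
... | false = length-filterᵇ p xs

∑-cong : (xs : List A) {f g : A → ℕ} → (∀ x → f x ≡ g x) → ∑ xs f ≡ ∑ xs g
∑-cong [] e = refl
∑-cong (x ∷ xs) e = cong₂ _+_ (e x) (∑-cong xs e)

∑-mono : (xs : List A) {f g : A → ℕ} → (∀ x → f x ≤ g x) → ∑ xs f ≤ ∑ xs g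
∑-mono [] e = z≤n
∑-mono (x ∷ xs) e = +-mono-≤ (e x) (∑-mono xs e)

∑-zero : (xs : List A) {f : A → ℕ} → (∀ x → f x ≡ 0) → ∑ xs f ≡ 0
∑-zero [] e = refl
∑-zero (x ∷ xs) e rewrite e x = ∑-zero xs e

∑-+ : (xs : List A) (f g : A → ℕ) → ∑[ x ← xs ] (f x + g x) ≡ ∑ xs f + ∑ xs g
∑-+ [] f g = refl
∑-+ (x ∷ xs) f g rewrite ∑-+ xs f g = +-interchange (f x) (g x) (∑ xs f) (∑ xs g)

∑-*ˡ : (xs : List A) (c : ℕ) (f : A → ℕ) → ∑[ x ← xs ] (c * f x) ≡ c * ∑ xs f
∑-*ˡ [] c f = sym (*-zeroʳ c)
∑-*ˡ (x ∷ xs) c f = trans (cong (c * f x +_) (∑-*ˡ xs c f)) (sym (*-distribˡ-+ c (f x) _))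

∑-*ʳ : (xs : List A) (c : ℕ) (f : A → ℕ) → ∑[ x ← xs ] (f x * c) ≡ ∑ xs f * c
∑-*ʳ xs c f = trans (∑-cong xs (λ x → *-comm (f x) c)) (trans (∑-*ˡ xs c f) (*-comm c _))

∑-swap : (xs : List A) (ys : List B) (h : A → B → ℕ)
  → ∑[ x ← xs ] ∑[ y ← ys ] h x y ≡ ∑[ y ← ys ] ∑[ x ← xs ] h x y
∑-swap [] ys h = sym (∑-zero ys (λ _ → refl))
∑-swap (x ∷ xs) ys h = trans (cong (∑ ys (h x) +_) (∑-swap xs ys h)) (sym (∑-+ ys (h x) _))

∑-++ : (xs ys : List A) (f : A → ℕ) → ∑ (xs ++ ys) f ≡ ∑ xs f + ∑ ys f
∑-++ [] ys f = refl
∑-++ (x ∷ xs) ys f = trans (cong (f x +_) (∑-++ xs ys f)) (sym (+-assoc (f x) _ _))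

∑-map : (g : A → B) (xs : List A) (f : B → ℕ) → ∑ (map g xs) f ≡ ∑[ x ← xs ] f (g x)
∑-map g [] f = refl
∑-map g (x ∷ xs) f = cong (f (g x) +_) (∑-map g xs f)

∑-concatMap : (g : A → List B) (xs : List A) (f : B → ℕ)
  → ∑ (concatMap g xs) f ≡ ∑[ x ← xs ] ∑ (g x) f
∑-concatMap g [] f = refl
∑-concatMap g (x ∷ xs) f = trans (∑-++ (g x) _ f) (cong (∑ (g x) f +_) (∑-concatMap g xs f))

∑-tabulate : (g : Fin k → A) (f : A → ℕ) → ∑ (tabulate g) f ≡ ∑[ r ← allFin k ] f (g r)
∑-tabulate {zero} g f = refl
∑-tabulate {suc k} g f =
  cong (f (g zero) +_) (trans (∑-tabulate (g ∘ suc) f) (sym (∑-tabulate suc (f ∘ g))))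

∑-allFin-suc : (h : Fin (suc k) → ℕ) → ∑ (allFin (suc k)) h ≡ h zero + ∑[ r ← allFin k ] h (suc r)
∑-allFin-suc h = cong (h zero +_) (∑-tabulate suc h)

∑-allFin-const : (k c : ℕ) → ∑[ r ← allFin k ] c ≡ k * c
∑-allFin-const zero c = refl
∑-allFin-const (suc k) c = trans (∑-allFin-suc {k} (λ _ → c)) (cong (c +_) (∑-allFin-const k c))

∑<-cong : (k : ℕ) {f g : ℕ → ℕ} → (∀ i → f i ≡ g i) → sum (applyUpTo f k) ≡ sum (applyUpTo g k)
∑<-cong zero e = refl
∑<-cong (suc k) e = cong₂ _+_ (e 0) (∑<-cong k (e ∘ suc))

∑<-swap : (k : ℕ) (xs : List A) (h : ℕ → A → ℕ)
  → sum (applyUpTo (λ i → ∑ xs (h i)) k) ≡ ∑[ x ← xs ] sum (applyUpTo (λ i → h i x) k)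
∑<-swap zero xs h = sym (∑-zero xs (λ _ → refl))
∑<-swap (suc k) xs h = trans (cong (∑ xs (h 0) +_) (∑<-swap k xs (h ∘ suc))) (sym (∑-+ xs (h 0) _))

∑<-*ʳ : (k : ℕ) (f : ℕ → ℕ) (c : ℕ) → sum (applyUpTo (λ i → f i * c) k) ≡ sum (applyUpTo f k) * c
∑<-*ʳ zero f c = refl
∑<-*ʳ (suc k) f c = trans (cong (f 0 * c +_) (∑<-*ʳ k (f ∘ suc) c)) (sym (*-distribʳ-+ c (f 0) _))

∑<-zero : (k : ℕ) {f : ℕ → ℕ} → (∀ i → f i ≡ 0) → sum (applyUpTo f k) ≡ 0
∑<-zero zero e = refl
∑<-zero (suc k) e = cong₂ _+_ (e 0) (∑<-zero k (e ∘ suc))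

∑<-indicator : (k x c d : ℕ) → (1 ≤ x → x ≤ k → c ≤ d)
  → sum (applyUpTo (λ i → 𝟙 (x ≡ᵇ suc i) * c) k) ≤ d
∑<-indicator zero x c d h = z≤n
∑<-indicator (suc k) zero c d h = ≤-trans (≤-reflexive (∑<-zero (suc k) (λ _ → refl))) z≤n
∑<-indicator (suc k) (suc zero) c d h = begin
  c + 0 + sum (applyUpTo (λ i → 𝟙 (1 ≡ᵇ suc (suc i)) * c) k) ≡⟨ cong (c + 0 +_) (∑<-zero k (λ _ → refl)) ⟩
  c + 0 + 0                                                   ≡⟨ +-identityʳ (c + 0) ⟩
  c + 0                                                       ≡⟨ +-identityʳ c ⟩
  c                                                           ≤⟨ h (s≤s z≤n) (s≤s z≤n) ⟩
  d                                                           ∎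
  where open ≤-Reasoning
∑<-indicator (suc k) (suc (suc x)) c d h = ∑<-indicator k (suc x) c d (λ _ x≤k → h (s≤s z≤n) (s≤s x≤k))

∧-split : {a b : Bool} → a ∧ b ≡ true → (a ≡ true) × (b ≡ true)
∧-split {true} {true} _ = refl , refl

∧-intro : {a b : Bool} → a ≡ true → b ≡ true → a ∧ b ≡ true
∧-intro refl refl = refl

clash : {a : Bool} → a ≡ true → a ≡ false → ⊥
clash refl ()

𝟙-∧ : (a b : Bool) → 𝟙 (a ∧ b) ≡ 𝟙 a * 𝟙 b
𝟙-∧ true b = sym (+-identityʳ (𝟙 b))
𝟙-∧ false b = refl

𝟙-split : (p q : Bool) → 𝟙 p ≡ 𝟙 (p ∧ not q) + 𝟙 (p ∧ q)
𝟙-split false q = refl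
𝟙-split true false = refl
𝟙-split true true = refl

𝟙-mono : {a b : Bool} → (a ≡ true → b ≡ true) → 𝟙 a ≤ 𝟙 b
𝟙-mono {false} _ = z≤n
𝟙-mono {true} a⇒b rewrite a⇒b refl = ≤-refl

𝟙-false : {a : Bool} → ¬ (a ≡ true) → 𝟙 a ≡ 0
𝟙-false {false} _ = refl
𝟙-false {true} ¬a = ⊥-elim (¬a refl)

≤-𝟙* : (b : Bool) {x d : ℕ} → (b ≡ true → x ≤ d) → (b ≡ false → x ≡ 0) → x ≤ 𝟙 b * d
≤-𝟙* true {d = d} bound _ = subst (_ ≤_) (sym (+-identityʳ d)) (bound refl)
≤-𝟙* false _ vanish = ≤-reflexive (vanish refl)

≡ᵇ-sound : {a b : ℕ} → (a ≡ᵇ b) ≡ true → a ≡ b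
≡ᵇ-sound {a} {b} e = ≡ᵇ⇒≡ a b (subst T (sym e) _)

≡ᵇ-refl : (a : ℕ) → (a ≡ᵇ a) ≡ true
≡ᵇ-refl zero = refl
≡ᵇ-refl (suc a) = ≡ᵇ-refl a

∑-subsets-suc : (f : Subset (suc n) → ℕ)
  → ∑ (allSubsets (suc n)) f ≡ ∑[ A ← allSubsets n ] (f (false ∷ A) + f (true ∷ A))
∑-subsets-suc {n} f = trans (∑-concatMap (λ A → (false ∷ A) ∷ (true ∷ A) ∷ []) (allSubsets n) f)
  (∑-cong (allSubsets n) (λ A → cong (f (false ∷ A) +_) (+-identityʳ (f (true ∷ A)))))

_⊆ᵇ_ : Subset n → Subset n → Bool
[] ⊆ᵇ [] = true
(a ∷ A) ⊆ᵇ (b ∷ B) = (not a ∨ b) ∧ (A ⊆ᵇ B)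

_==_ : Subset n → Subset n → Bool
[] == [] = true
(false ∷ A) == (false ∷ B) = A == B
(true ∷ A) == (true ∷ B) = A == B
(_ ∷ _) == (_ ∷ _) = false

==-sound : (A B : Subset n) → A == B ≡ true → A ≡ B
==-sound [] [] _ = refl
==-sound (false ∷ A) (false ∷ B) e = cong (false ∷_) (==-sound A B e)
==-sound (true ∷ A) (true ∷ B) e = cong (true ∷_) (==-sound A B e)

==-refl : (A : Subset n) → A == A ≡ true
==-refl [] = refl
==-refl (false ∷ A) = ==-refl A
==-refl (true ∷ A) = ==-refl A

==-unique : (X : Subset n) → count (_== X) (allSubsets n) ≡ 1
==-unique [] = refl
==-unique {suc n} (false ∷ X) = trans (∑-subsets-suc (λ Z → 𝟙 (Z == (false ∷ X))))
  (trans (∑-cong (allSubsets n) (λ Z → +-identityʳ _)) (==-unique X))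
==-unique {suc n} (true ∷ X) = trans (∑-subsets-suc (λ Z → 𝟙 (Z == (true ∷ X)))) (==-unique X)

count-injection : (p q : Subset n → Bool) (φ ψ : Subset n → Subset n)
  → (∀ B → p B ≡ true → (q (φ B) ≡ true) × (ψ (φ B) ≡ B))
  → count p (allSubsets n) ≤ count q (allSubsets n)
count-injection {n} p q φ ψ inj = begin
  ∑[ B ← 𝒫 ] 𝟙 (p B)                                      ≡⟨ ∑-cong 𝒫 (λ B → sym (pick (φ B) (𝟙 (p B)))) ⟩
  ∑[ B ← 𝒫 ] ∑[ Z ← 𝒫 ] (𝟙 (Z == φ B) * 𝟙 (p B))       ≤⟨ ∑-mono 𝒫 (λ B → ∑-mono 𝒫 (λ Z → reindex B Z)) ⟩
  ∑[ B ← 𝒫 ] ∑[ Z ← 𝒫 ] (𝟙 (B == ψ Z) * 𝟙 (q Z))       ≡⟨ ∑-swap 𝒫 𝒫 _ ⟩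
  ∑[ Z ← 𝒫 ] ∑[ B ← 𝒫 ] (𝟙 (B == ψ Z) * 𝟙 (q Z))       ≡⟨ ∑-cong 𝒫 (λ Z → pick (ψ Z) (𝟙 (q Z))) ⟩
  ∑[ Z ← 𝒫 ] 𝟙 (q Z)                                      ∎
  where
  open ≤-Reasoning
  𝒫 = allSubsets n
  pick : (X : Subset n) (c : ℕ) → ∑[ Z ← 𝒫 ] (𝟙 (Z == X) * c) ≡ c
  pick X c = trans (∑-*ʳ 𝒫 c (λ Z → 𝟙 (Z == X))) (trans (cong (_* c) (==-unique X)) (+-identityʳ c))
  reindex : ∀ B Z → 𝟙 (Z == φ B) * 𝟙 (p B) ≤ 𝟙 (B == ψ Z) * 𝟙 (q Z)
  reindex B Z rewrite sym (𝟙-∧ (Z == φ B) (p B)) | sym (𝟙-∧ (B == ψ Z) (q Z)) = 𝟙-mono step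
    where
    step : (Z == φ B) ∧ p B ≡ true → (B == ψ Z) ∧ q Z ≡ true
    step h with ∧-split {Z == φ B} h
    ... | Z≡φB , pB with ==-sound Z (φ B) Z≡φB | inj B pB
    ... | refl | qφB , ψφB = ∧-intro (subst (λ X → B == X ≡ true) (sym ψφB) (==-refl B)) qφB

⊆ᵇ-refl : (A : Subset n) → A ⊆ᵇ A ≡ true
⊆ᵇ-refl [] = refl
⊆ᵇ-refl (true ∷ A) = ⊆ᵇ-refl A
⊆ᵇ-refl (false ∷ A) = ⊆ᵇ-refl A

⊆ᵇ-full : (A : Subset n) → A ⊆ᵇ full ≡ true
⊆ᵇ-full [] = refl
⊆ᵇ-full (true ∷ A) = ⊆ᵇ-full A
⊆ᵇ-full (false ∷ A) = ⊆ᵇ-full A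

⊆ᵇ-∪ : (A B : Subset n) → A ⊆ᵇ (A ∪ B) ≡ true
⊆ᵇ-∪ [] [] = refl
⊆ᵇ-∪ (true ∷ A) (b ∷ B) = ⊆ᵇ-∪ A B
⊆ᵇ-∪ (false ∷ A) (b ∷ B) = ⊆ᵇ-∪ A B

disj-sym : (A B : Subset n) → disjᵇ A B ≡ true → disjᵇ B A ≡ true
disj-sym [] [] h = refl
disj-sym (true ∷ A) (false ∷ B) h = disj-sym A B h
disj-sym (false ∷ A) (true ∷ B) h = disj-sym A B h
disj-sym (false ∷ A) (false ∷ B) h = disj-sym A B h

⊆─⇒⊆ : (B Y A : Subset n) → B ⊆ᵇ (Y ─ A) ≡ true → B ⊆ᵇ Y ≡ true
⊆─⇒⊆ [] [] [] h = refl
⊆─⇒⊆ (false ∷ B) (y ∷ Y) (a ∷ A) h = ⊆─⇒⊆ B Y A h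
⊆─⇒⊆ (true ∷ B) (true ∷ Y) (false ∷ A) h = ⊆─⇒⊆ B Y A h

⊆─⇒disj : (B Y A : Subset n) → B ⊆ᵇ (Y ─ A) ≡ true → disjᵇ A B ≡ true
⊆─⇒disj [] [] [] h = refl
⊆─⇒disj (false ∷ B) (y ∷ Y) (true ∷ A) h = ⊆─⇒disj B Y A h
⊆─⇒disj (false ∷ B) (y ∷ Y) (false ∷ A) h = ⊆─⇒disj B Y A h
⊆─⇒disj (true ∷ B) (true ∷ Y) (false ∷ A) h = ⊆─⇒disj B Y A h

⊆⇒⊆─ : (B Y A : Subset n) → B ⊆ᵇ Y ≡ true → disjᵇ A B ≡ true → B ⊆ᵇ (Y ─ A) ≡ true
⊆⇒⊆─ [] [] [] h d = refl
⊆⇒⊆─ (false ∷ B) (y ∷ Y) (true ∷ A) h d = ⊆⇒⊆─ B Y A h d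
⊆⇒⊆─ (false ∷ B) (y ∷ Y) (false ∷ A) h d = ⊆⇒⊆─ B Y A h d
⊆⇒⊆─ (true ∷ B) (true ∷ Y) (false ∷ A) h d = ⊆⇒⊆─ B Y A h d

─-⊆ᵇ : (Y B : Subset n) → (Y ─ B) ⊆ᵇ Y ≡ true
─-⊆ᵇ Y B = ⊆─⇒⊆ (Y ─ B) Y B (⊆ᵇ-refl (Y ─ B))

disj-─ : (B Y : Subset n) → disjᵇ B (Y ─ B) ≡ true
disj-─ B Y = ⊆─⇒disj (Y ─ B) Y B (⊆ᵇ-refl (Y ─ B))

disj-⊆ : (Z Y B : Subset n) → disjᵇ Z Y ≡ true → B ⊆ᵇ Y ≡ true → disjᵇ Z B ≡ true
disj-⊆ [] [] [] h₁ h₂ = refl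
disj-⊆ (true ∷ Z) (false ∷ Y) (false ∷ B) h₁ h₂ = disj-⊆ Z Y B h₁ h₂
disj-⊆ (false ∷ Z) (true ∷ Y) (false ∷ B) h₁ h₂ = disj-⊆ Z Y B h₁ h₂
disj-⊆ (false ∷ Z) (true ∷ Y) (true ∷ B) h₁ h₂ = disj-⊆ Z Y B h₁ h₂
disj-⊆ (false ∷ Z) (false ∷ Y) (false ∷ B) h₁ h₂ = disj-⊆ Z Y B h₁ h₂

disj-∪ˡ : (A B Z : Subset n) → disjᵇ A Z ≡ true → disjᵇ B Z ≡ true → disjᵇ (A ∪ B) Z ≡ true
disj-∪ˡ [] [] [] h₁ h₂ = refl
disj-∪ˡ (true ∷ A) (true ∷ B) (false ∷ Z) h₁ h₂ = disj-∪ˡ A B Z h₁ h₂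
disj-∪ˡ (true ∷ A) (false ∷ B) (false ∷ Z) h₁ h₂ = disj-∪ˡ A B Z h₁ h₂
disj-∪ˡ (false ∷ A) (true ∷ B) (false ∷ Z) h₁ h₂ = disj-∪ˡ A B Z h₁ h₂
disj-∪ˡ (false ∷ A) (false ∷ B) (false ∷ Z) h₁ h₂ = disj-∪ˡ A B Z h₁ h₂
disj-∪ˡ (false ∷ A) (false ∷ B) (true ∷ Z) h₁ h₂ = disj-∪ˡ A B Z h₁ h₂

disj-∪ʳ : (Z A B : Subset n) → disjᵇ Z A ≡ true → disjᵇ Z B ≡ true → disjᵇ Z (A ∪ B) ≡ true
disj-∪ʳ Z A B h₁ h₂ = disj-sym (A ∪ B) Z (disj-∪ˡ A B Z (disj-sym Z A h₁) (disj-sym Z B h₂))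

∪-─ : (A B : Subset n) → disjᵇ A B ≡ true → (A ∪ B) ─ A ≡ B
∪-─ [] [] h = refl
∪-─ (true ∷ A) (false ∷ B) h = cong (false ∷_) (∪-─ A B h)
∪-─ (false ∷ A) (true ∷ B) h = cong (true ∷_) (∪-─ A B h)
∪-─ (false ∷ A) (false ∷ B) h = cong (false ∷_) (∪-─ A B h)

∣─∣ : (Y B : Subset n) → B ⊆ᵇ Y ≡ true → ∣ Y ─ B ∣ ≡ ∣ Y ∣ ∸ ∣ B ∣
∣─∣ Y B h = trans (sym (m+n∸n≡m ∣ Y ─ B ∣ ∣ B ∣)) (cong (_∸ ∣ B ∣) (split Y B h))
  where
  split : {n : ℕ} (Y B : Subset n) → B ⊆ᵇ Y ≡ true → ∣ Y ─ B ∣ + ∣ B ∣ ≡ ∣ Y ∣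
  split [] [] h = refl
  split (true ∷ Y) (true ∷ B) h = trans (+-suc ∣ Y ─ B ∣ ∣ B ∣) (cong suc (split Y B h))
  split (true ∷ Y) (false ∷ B) h = cong suc (split Y B h)
  split (false ∷ Y) (false ∷ B) h = split Y B h

∣∪∣ : (A B : Subset n) → disjᵇ A B ≡ true → ∣ A ∪ B ∣ ≡ ∣ A ∣ + ∣ B ∣
∣∪∣ [] [] h = refl
∣∪∣ (true ∷ A) (false ∷ B) h = cong suc (∣∪∣ A B h)
∣∪∣ (false ∷ A) (true ∷ B) h = trans (cong suc (∣∪∣ A B h)) (sym (+-suc ∣ A ∣ ∣ B ∣))
∣∪∣ (false ∷ A) (false ∷ B) h = ∣∪∣ A B h

C-factorial : {a b : ℕ} → b ≤ a → (a C b) * (b ! * (a ∸ b) !) ≡ a !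
C-factorial {a} {b} b≤a = trans (cong (_* (b ! * (a ∸ b) !)) (nCk≡n!/k![n-k]! b≤a))
  (m/n*n≡m {{b !* (a ∸ b) !≢0}} (k![n∸k]!∣n! b≤a))

C-positive : {a b : ℕ} → b ≤ a → 1 ≤ a C b
C-positive {a} {b} b≤a with a C b | C-factorial b≤a
... | zero | 0≡a! = ⊥-elim (<⇒≢ (1≤n! a) 0≡a!)
... | suc _ | _ = s≤s z≤n

chosen : Subset n → ℕ → Subset n → Bool
chosen Y j B = (B ⊆ᵇ Y) ∧ (∣ B ∣ ≡ᵇ j)

chosen-⊆ : (Y B : Subset n) {j : ℕ} → chosen Y j B ≡ true → B ⊆ᵇ Y ≡ true
chosen-⊆ Y B h = proj₁ (∧-split {B ⊆ᵇ Y} h)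

chosen-size : (Y B : Subset n) {j : ℕ} → chosen Y j B ≡ true → ∣ B ∣ ≡ j
chosen-size Y B h = ≡ᵇ-sound (proj₂ (∧-split {B ⊆ᵇ Y} h))

chosen-in : (Y Y′ B : Subset n) {j : ℕ} → chosen Y j B ≡ true → B ⊆ᵇ Y′ ≡ true → chosen Y′ j B ≡ true
chosen-in Y Y′ B h B⊆Y′ = ∧-intro B⊆Y′ (proj₂ (∧-split {B ⊆ᵇ Y} h))

∣─chosen∣ : (Y B : Subset n) {j : ℕ} → chosen Y j B ≡ true → ∣ Y ─ B ∣ ≡ ∣ Y ∣ ∸ j
∣─chosen∣ Y B h = trans (∣─∣ Y B (chosen-⊆ Y B h)) (cong (∣ Y ∣ ∸_) (chosen-size Y B h))

-- Pascal's rule read off from the first point: a j-subset of (true ∷ Y) either omits that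
-- point (a j-subset of Y) or contains it (plus a (j−1)-subset of Y).
count-chosen : (Y : Subset n) (j : ℕ) → count (chosen Y j) (allSubsets n) ≡ ∣ Y ∣ C j
count-chosen [] zero = refl
count-chosen [] (suc j) = refl
count-chosen {suc n} (false ∷ Y) j = begin
  count (chosen (false ∷ Y) j) (allSubsets (suc n)) ≡⟨ ∑-subsets-suc (𝟙 ∘ chosen (false ∷ Y) j) ⟩
  ∑[ B ← allSubsets n ] (𝟙 (chosen Y j B) + 0)      ≡⟨ ∑-cong (allSubsets n) (λ B → +-identityʳ _) ⟩
  count (chosen Y j) (allSubsets n)                 ≡⟨ count-chosen Y j ⟩
  ∣ Y ∣ C j                                         ∎
  where open ≡-Reasoning
count-chosen {suc n} (true ∷ Y) zero = begin
  count (chosen (true ∷ Y) zero) (allSubsets (suc n))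
    ≡⟨ ∑-subsets-suc (𝟙 ∘ chosen (true ∷ Y) zero) ⟩
  ∑[ B ← allSubsets n ] (𝟙 (chosen Y zero B) + 𝟙 ((B ⊆ᵇ Y) ∧ false))
    ≡⟨ ∑-cong (allSubsets n) (λ B → cong (λ b → 𝟙 (chosen Y zero B) + 𝟙 b) (∧-zeroʳ (B ⊆ᵇ Y))) ⟩
  ∑[ B ← allSubsets n ] (𝟙 (chosen Y zero B) + 0)
    ≡⟨ ∑-cong (allSubsets n) (λ B → +-identityʳ _) ⟩
  count (chosen Y zero) (allSubsets n)
    ≡⟨ count-chosen Y zero ⟩
  1 ∎
  where open ≡-Reasoning
count-chosen {suc n} (true ∷ Y) (suc j) = begin
  count (chosen (true ∷ Y) (suc j)) (allSubsets (suc n))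
    ≡⟨ ∑-subsets-suc (𝟙 ∘ chosen (true ∷ Y) (suc j)) ⟩
  ∑[ B ← allSubsets n ] (𝟙 (chosen Y (suc j) B) + 𝟙 (chosen Y j B))
    ≡⟨ ∑-+ (allSubsets n) _ _ ⟩
  count (chosen Y (suc j)) (allSubsets n) + count (chosen Y j) (allSubsets n)
    ≡⟨ cong₂ _+_ (count-chosen Y (suc j)) (count-chosen Y j) ⟩
  ∣ Y ∣ C suc j + ∣ Y ∣ C j
    ≡⟨ +-comm (∣ Y ∣ C suc j) _ ⟩
  ∣ Y ∣ C j + ∣ Y ∣ C suc j
    ≡⟨ nCk+nC[k+1]≡[n+1]C[k+1] ∣ Y ∣ j ⟩
  suc ∣ Y ∣ C suc j ∎
  where open ≡-Reasoning

allᵇ-map : {p q : A → Bool} → (∀ x → p x ≡ true → q x ≡ true)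
  → (T : Vec A k) → allᵇ p T ≡ true → allᵇ q T ≡ true
allᵇ-map f [] _ = refl
allᵇ-map f (x ∷ T) h = ∧-intro (f x (proj₁ (∧-split h))) (allᵇ-map f T (proj₂ (∧-split h)))

allᵇ-zip : {p q r : A → Bool} → (∀ x → p x ≡ true → q x ≡ true → r x ≡ true)
  → (T : Vec A k) → allᵇ p T ≡ true → allᵇ q T ≡ true → allᵇ r T ≡ true
allᵇ-zip f [] _ _ = refl
allᵇ-zip f (x ∷ T) h h′ =
  ∧-intro (f x (proj₁ (∧-split h)) (proj₁ (∧-split h′))) (allᵇ-zip f T (proj₂ (∧-split h)) (proj₂ (∧-split h′)))

allᵇ-head : {p : A → Bool} {x : A} (T : Vec A k) → allᵇ p (x ∷ T) ≡ true → p x ≡ true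
allᵇ-head {p = p} {x} T h = proj₁ (∧-split {p x} h)

allᵇ-tail : {p : A → Bool} {x : A} (T : Vec A k) → allᵇ p (x ∷ T) ≡ true → allᵇ p T ≡ true
allᵇ-tail {p = p} {x} T h = proj₂ (∧-split {p x} h)

allᵇ-lookup : {p : A → Bool} (T : Vec A k) → allᵇ p T ≡ true → ∀ r → p (lookup T r) ≡ true
allᵇ-lookup (x ∷ T) h zero = proj₁ (∧-split h)
allᵇ-lookup (x ∷ T) h (suc r) = allᵇ-lookup T (proj₂ (∧-split h)) r

tuples : (k n : ℕ) → List (Vec (Subset n) k)
tuples k n = allTuples k (allSubsets n)

∑-tuples-suc : (f : Vec (Subset n) (suc k) → ℕ)
  → ∑ (tuples (suc k) n) f ≡ ∑[ A ← allSubsets n ] ∑[ T ← tuples k n ] f (A ∷ T)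
∑-tuples-suc {n} {k} f = trans (∑-concatMap (λ A → map (A ∷_) (tuples k n)) (allSubsets n) f)
  (∑-cong (allSubsets n) (λ A → ∑-map (A ∷_) (tuples k n) f))

count-by-head : (P : Vec (Subset n) (suc k) → Bool) (h : Subset n → Bool) (b : ℕ)
  → (∀ A T → P (A ∷ T) ≡ true → h A ≡ true)
  → (∀ A → h A ≡ true → count (λ T → P (A ∷ T)) (tuples k n) ≤ b)
  → count P (tuples (suc k) n) ≤ count h (allSubsets n) * b
count-by-head {n} {k} P h b head extend = begin
  count P (tuples (suc k) n)                         ≡⟨ ∑-tuples-suc (𝟙 ∘ P) ⟩
  ∑[ A ← allSubsets n ] count (λ T → P (A ∷ T)) (tuples k n) ≤⟨ ∑-mono (allSubsets n) bound ⟩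
  ∑[ A ← allSubsets n ] (𝟙 (h A) * b)               ≡⟨ ∑-*ʳ (allSubsets n) b (𝟙 ∘ h) ⟩
  count h (allSubsets n) * b                         ∎
  where
  open ≤-Reasoning
  bound : ∀ A → count (λ T → P (A ∷ T)) (tuples k n) ≤ 𝟙 (h A) * b
  bound A = ≤-𝟙* (h A) (extend A)
    (λ ¬hA → ∑-zero (tuples k n) (λ T → 𝟙-false (λ P[A∷T] → clash (head A T P[A∷T]) ¬hA)))

arrangements : (m N k : ℕ) → ℕ
arrangements m N zero = 1
arrangements m N (suc k) = (N C m) * arrangements m (N ∸ m) k

traps : Subset n → Fin k → Vec (Subset n) k → Bool
traps Z zero (A ∷ T) = (A ⊆ᵇ Z) ∧ allᵇ (disjᵇ Z) T
traps Z (suc r) (A ∷ T) = disjᵇ Z A ∧ traps Z r T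

module Packings (m : ℕ) where

  packed : Subset n → Vec (Subset n) k → Bool
  packed X T = allᵇ (chosen X m) T ∧ pairwiseDisjᵇ T

  chosen-─ : {j : ℕ} (X A A′ : Subset n) → chosen X j A′ ≡ true → disjᵇ A A′ ≡ true → chosen (X ─ A) j A′ ≡ true
  chosen-─ X A A′ h d = chosen-in X (X ─ A) A′ h (⊆⇒⊆─ A′ X A (chosen-⊆ X A′ h) d)

  packed-head : (X A : Subset n) (T : Vec (Subset n) k) → packed X (A ∷ T) ≡ true → chosen X m A ≡ true
  packed-head X A T h = allᵇ-head {p = chosen X m} {A} T (proj₁ (∧-split {allᵇ (chosen X m) (A ∷ T)} h))

  packed-tail : (X A : Subset n) (T : Vec (Subset n) k) → packed X (A ∷ T) ≡ true → packed (X ─ A) T ≡ true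
  packed-tail X A T h with ∧-split {allᵇ (chosen X m) (A ∷ T)} h
  ... | inX , disj with ∧-split {allᵇ (disjᵇ A) T} disj
  ... | A-disj-T , T-disj = ∧-intro (allᵇ-zip (chosen-─ X A) T (allᵇ-tail {p = chosen X m} {A} T inX) A-disj-T) T-disj

  packed-drop : (X A : Subset n) (T : Vec (Subset n) k) → packed X (A ∷ T) ≡ true → packed X T ≡ true
  packed-drop X A T h with ∧-split {allᵇ (chosen X m) (A ∷ T)} h
  ... | inX , disj = ∧-intro (allᵇ-tail {p = chosen X m} {A} T inX) (proj₂ (∧-split {allᵇ (disjᵇ A) T} disj))

  count-packed : (k : ℕ) (X : Subset n) → count (packed X) (tuples k n) ≤ arrangements m ∣ X ∣ k
  count-packed zero X = ≤-refl
  count-packed {n} (suc k) X = begin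
    count (packed X) (tuples (suc k) n)                    ≤⟨ count-by-head (packed X) (chosen X m) (arrangements m (∣ X ∣ ∸ m) k) (packed-head X) extend ⟩
    count (chosen X m) (allSubsets n) * arrangements m (∣ X ∣ ∸ m) k ≡⟨ cong (_* arrangements m (∣ X ∣ ∸ m) k) (count-chosen X m) ⟩
    arrangements m ∣ X ∣ (suc k)                           ∎
    where
    open ≤-Reasoning
    extend : ∀ A → chosen X m A ≡ true → count (λ T → packed X (A ∷ T)) (tuples k n) ≤ arrangements m (∣ X ∣ ∸ m) k
    extend A hA = begin
      count (λ T → packed X (A ∷ T)) (tuples k n) ≤⟨ ∑-mono (tuples k n) (λ T → 𝟙-mono (packed-tail X A T)) ⟩
      count (packed (X ─ A)) (tuples k n)         ≤⟨ count-packed k (X ─ A) ⟩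
      arrangements m ∣ X ─ A ∣ k                  ≡⟨ cong (λ N → arrangements m N k) (∣─chosen∣ X A hA) ⟩
      arrangements m (∣ X ∣ ∸ m) k                ∎

  -- Packings of X whose first entry is trapped by Z ⊆ X: that entry is an m-subset of Z,
  -- and the remaining entries form a packing of X − Z.
  count-traps-first : (k : ℕ) (X Z : Subset n) → Z ⊆ᵇ X ≡ true
    → count (λ T → packed X T ∧ traps Z zero T) (tuples (suc k) n) ≤ (∣ Z ∣ C m) * arrangements m (∣ X ∣ ∸ ∣ Z ∣) k
  count-traps-first {n} k X Z Z⊆X = begin
    count (λ T → packed X T ∧ traps Z zero T) (tuples (suc k) n) ≤⟨ count-by-head _ (chosen Z m) rest head extend ⟩
    count (chosen Z m) (allSubsets n) * rest                     ≡⟨ cong (_* rest) (count-chosen Z m) ⟩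
    (∣ Z ∣ C m) * rest                                           ∎
    where
    open ≤-Reasoning
    rest = arrangements m (∣ X ∣ ∸ ∣ Z ∣) k
    head : ∀ A T → (packed X (A ∷ T) ∧ traps Z zero (A ∷ T)) ≡ true → chosen Z m A ≡ true
    head A T h with ∧-split {packed X (A ∷ T)} h
    ... | p , t = chosen-in X Z A (packed-head X A T p) (proj₁ (∧-split {A ⊆ᵇ Z} t))
    tail : ∀ A T → (packed X (A ∷ T) ∧ traps Z zero (A ∷ T)) ≡ true → packed (X ─ Z) T ≡ true
    tail A T h with ∧-split {packed X (A ∷ T)} h
    ... | p , t with ∧-split {allᵇ (chosen X m) (A ∷ T)} p
    ... | inX , disj = ∧-intro (allᵇ-zip (chosen-─ X Z) T (allᵇ-tail {p = chosen X m} {A} T inX) (proj₂ (∧-split {A ⊆ᵇ Z} t)))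
                              (proj₂ (∧-split {allᵇ (disjᵇ A) T} disj))
    extend : ∀ A → chosen Z m A ≡ true → count (λ T → packed X (A ∷ T) ∧ traps Z zero (A ∷ T)) (tuples k n) ≤ rest
    extend A _ = begin
      count (λ T → packed X (A ∷ T) ∧ traps Z zero (A ∷ T)) (tuples k n) ≤⟨ ∑-mono (tuples k n) (λ T → 𝟙-mono (tail A T)) ⟩
      count (packed (X ─ Z)) (tuples k n)                              ≤⟨ count-packed k (X ─ Z) ⟩
      arrangements m ∣ X ─ Z ∣ k                                       ≡⟨ cong (λ N → arrangements m N k) (∣─∣ X Z Z⊆X) ⟩
      rest                                                             ∎

  -- Packings of X whose r-th entry is trapped by Z ⊆ X: the entries before position r are
  -- m-subsets of X − Z, and removing them reduces to count-traps-first.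
  count-traps : (k : ℕ) (r : Fin (suc k)) (X Z : Subset n) → Z ⊆ᵇ X ≡ true
    → count (λ T → packed X T ∧ traps Z r T) (tuples (suc k) n) ≤ (∣ Z ∣ C m) * arrangements m (∣ X ∣ ∸ ∣ Z ∣) k
  count-traps k zero X Z Z⊆X = count-traps-first k X Z Z⊆X
  count-traps {n} (suc k) (suc r) X Z Z⊆X = begin
    count (λ T → packed X T ∧ traps Z (suc r) T) (tuples (suc (suc k)) n)
      ≤⟨ count-by-head _ (chosen (X ─ Z) m) rest head extend ⟩
    count (chosen (X ─ Z) m) (allSubsets n) * rest
      ≡⟨ cong (_* rest) (trans (count-chosen (X ─ Z) m) (cong (_C m) (∣─∣ X Z Z⊆X))) ⟩
    ((∣ X ∣ ∸ ∣ Z ∣) C m) * ((∣ Z ∣ C m) * arrangements m (∣ X ∣ ∸ ∣ Z ∣ ∸ m) k)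
      ≡⟨ *-left-swap ((∣ X ∣ ∸ ∣ Z ∣) C m) (∣ Z ∣ C m) _ ⟩
    (∣ Z ∣ C m) * arrangements m (∣ X ∣ ∸ ∣ Z ∣) (suc k) ∎
    where
    open ≤-Reasoning
    rest = (∣ Z ∣ C m) * arrangements m (∣ X ∣ ∸ ∣ Z ∣ ∸ m) k
    ∸-swap : ∀ a b c → a ∸ b ∸ c ≡ a ∸ c ∸ b
    ∸-swap a b c = trans (∸-+-assoc a b c) (trans (cong (a ∸_) (+-comm b c)) (sym (∸-+-assoc a c b)))
    head : ∀ A T → (packed X (A ∷ T) ∧ traps Z (suc r) (A ∷ T)) ≡ true → chosen (X ─ Z) m A ≡ true
    head A T h with ∧-split {packed X (A ∷ T)} h
    ... | p , t = chosen-─ X Z A (packed-head X A T p) (proj₁ (∧-split {disjᵇ Z A} t))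
    tail : ∀ A T → (packed X (A ∷ T) ∧ traps Z (suc r) (A ∷ T)) ≡ true → (packed (X ─ A) T ∧ traps Z r T) ≡ true
    tail A T h with ∧-split {packed X (A ∷ T)} h
    ... | p , t = ∧-intro (packed-tail X A T p) (proj₂ (∧-split {disjᵇ Z A} t))
    extend : ∀ A → chosen (X ─ Z) m A ≡ true
      → count (λ T → packed X (A ∷ T) ∧ traps Z (suc r) (A ∷ T)) (tuples (suc k) n) ≤ rest
    extend A hA = begin
      count (λ T → packed X (A ∷ T) ∧ traps Z (suc r) (A ∷ T)) (tuples (suc k) n)
        ≤⟨ ∑-mono (tuples (suc k) n) (λ T → 𝟙-mono (tail A T)) ⟩
      count (λ T → packed (X ─ A) T ∧ traps Z r T) (tuples (suc k) n)
        ≤⟨ count-traps k r (X ─ A) Z Z⊆X─A ⟩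
      (∣ Z ∣ C m) * arrangements m (∣ X ─ A ∣ ∸ ∣ Z ∣) k
        ≡⟨ cong (λ N → (∣ Z ∣ C m) * arrangements m (N ∸ ∣ Z ∣) k) (∣─chosen∣ X A A-in-X) ⟩
      (∣ Z ∣ C m) * arrangements m (∣ X ∣ ∸ m ∸ ∣ Z ∣) k
        ≡⟨ cong (λ N → (∣ Z ∣ C m) * arrangements m N k) (∸-swap (∣ X ∣) m (∣ Z ∣)) ⟩
      rest ∎
      where
      A⊆X─Z = chosen-⊆ (X ─ Z) A hA
      A-in-X = chosen-in (X ─ Z) X A hA (⊆─⇒⊆ A X Z A⊆X─Z)
      Z⊆X─A = ⊆⇒⊆─ Z X A Z⊆X (disj-sym Z A (⊆─⇒disj A X Z A⊆X─Z))

arrangements-factorial : (m N k : ℕ) → k * m ≤ N → arrangements m N k * ((N ∸ k * m) ! * (m !) ^ k) ≡ N !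
arrangements-factorial m N zero _ = trans (*-identityˡ _) (*-identityʳ _)
arrangements-factorial m N (suc k) km≤N = begin
  (N C m) * arrangements m N′ k * ((N ∸ (m + k * m)) ! * (m ! * (m !) ^ k))
    ≡⟨ cong (λ x → (N C m) * arrangements m N′ k * (x ! * (m ! * (m !) ^ k))) (sym (∸-+-assoc N m (k * m))) ⟩
  (N C m) * arrangements m N′ k * ((N′ ∸ k * m) ! * (m ! * (m !) ^ k))
    ≡⟨ regroup (N C m) (arrangements m N′ k) ((N′ ∸ k * m) !) (m !) ((m !) ^ k) ⟩
  (N C m) * (m ! * (arrangements m N′ k * ((N′ ∸ k * m) ! * (m !) ^ k)))
    ≡⟨ cong (λ x → (N C m) * (m ! * x)) (arrangements-factorial m N′ k km≤N′) ⟩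
  (N C m) * (m ! * N′ !)
    ≡⟨ C-factorial m≤N ⟩
  N ! ∎
  where
  open ≡-Reasoning
  N′ = N ∸ m
  m≤N : m ≤ N
  m≤N = ≤-trans (m≤m+n m (k * m)) km≤N
  km≤N′ : k * m ≤ N′
  km≤N′ = ≤-trans (≤-reflexive (sym (m+n∸m≡n m (k * m)))) (∸-monoˡ-≤ m km≤N)
  regroup : ∀ c a f x p → c * a * (f * (x * p)) ≡ c * (x * (a * (f * p)))
  regroup = solve-∀

denominator : (m s′ t u : ℕ) → ℕ
denominator m s′ t u = m ! * u ! * (t ∸ u) ! * (m !) ^ s′

-- Counting arrangements of s = 1 + s′ disjoint m-sets in [N], N = sm + t, with u of the t
-- leftover points marked, by first choosing the first m-set together with the u marks as an
-- (m+u)-set, then splitting it, then arranging the other s′ sets in the rest.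
choose-first-count : (m s′ t u : ℕ) → u ≤ t →
  ((m + u) C m) * arrangements m ((suc s′ * m + t) ∸ (m + u)) s′ * ((suc s′ * m + t) C (m + u))
    * denominator m s′ t u ≡ (suc s′ * m + t) !
choose-first-count m s′ t u u≤t = begin
  ((m + u) C m) * arrangements m rest s′ * (N C (m + u)) * (m ! * u ! * (t ∸ u) ! * p)
    ≡⟨ regroup ((m + u) C m) (arrangements m rest s′) (N C (m + u)) (m !) (u !) ((t ∸ u) !) p ⟩
  (N C (m + u)) * ((((m + u) C m) * (m ! * u !)) * (arrangements m rest s′ * ((t ∸ u) ! * p)))
    ≡⟨ cong₂ (λ x y → (N C (m + u)) * (x * y)) split-chosen arrange-rest ⟩
  (N C (m + u)) * ((m + u) ! * rest !)
    ≡⟨ C-factorial m+u≤N ⟩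
  N ! ∎
  where
  open ≡-Reasoning
  N = suc s′ * m + t
  rest = N ∸ (m + u)
  p = (m !) ^ s′
  rest≡ : rest ≡ s′ * m + (t ∸ u)
  rest≡ = begin
    (m + s′ * m + t) ∸ (m + u) ≡⟨ sym (∸-+-assoc (m + s′ * m + t) m u) ⟩
    (m + s′ * m + t) ∸ m ∸ u   ≡⟨ cong (_∸ u) (trans (cong (_∸ m) (+-assoc m (s′ * m) t)) (m+n∸m≡n m (s′ * m + t))) ⟩
    (s′ * m + t) ∸ u           ≡⟨ +-∸-assoc (s′ * m) u≤t ⟩
    s′ * m + (t ∸ u)           ∎
  m+u≤N : m + u ≤ N
  m+u≤N = ≤-trans (+-monoʳ-≤ m u≤t) (+-monoˡ-≤ t (m≤m+n m (s′ * m)))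
  split-chosen : ((m + u) C m) * (m ! * u !) ≡ (m + u) !
  split-chosen = trans (cong (λ x → ((m + u) C m) * (m ! * x !)) (sym (m+n∸m≡n m u))) (C-factorial (m≤m+n m u))
  arrange-rest : arrangements m rest s′ * ((t ∸ u) ! * p) ≡ rest !
  arrange-rest = trans
    (cong (λ x → arrangements m rest s′ * (x ! * p)) (sym (trans (cong (_∸ s′ * m) rest≡) (m+n∸m≡n (s′ * m) (t ∸ u)))))
    (arrangements-factorial m rest s′ (≤-trans (m≤m+n (s′ * m) (t ∸ u)) (≤-reflexive (sym rest≡))))
  regroup : ∀ b a c x y z p → b * a * c * (x * y * z * p) ≡ c * ((b * (x * y)) * (a * (z * p)))
  regroup = solve-∀

-- The same count, by first arranging all s sets and then marking u of the t leftover points.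
arrange-first-count : (m s′ t u : ℕ) → u ≤ t →
  (t C u) * arrangements m (suc s′ * m + t) (suc s′) * denominator m s′ t u ≡ (suc s′ * m + t) !
arrange-first-count m s′ t u u≤t = begin
  (t C u) * D * (m ! * u ! * (t ∸ u) ! * p)
    ≡⟨ regroup (t C u) D (m !) (u !) ((t ∸ u) !) p ⟩
  D * (((t C u) * (u ! * (t ∸ u) !)) * (m ! * p))
    ≡⟨ cong (λ x → D * (x * (m ! * p))) (C-factorial u≤t) ⟩
  D * (t ! * (m ! * p))
    ≡⟨ cong (λ x → D * (x ! * (m ! * p))) (sym (m+n∸m≡n (suc s′ * m) t)) ⟩
  D * ((N ∸ suc s′ * m) ! * (m !) ^ suc s′)
    ≡⟨ arrangements-factorial m N (suc s′) (m≤m+n (suc s′ * m) t) ⟩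
  N ! ∎
  where
  open ≡-Reasoning
  N = suc s′ * m + t
  D = arrangements m N (suc s′)
  p = (m !) ^ s′
  regroup : ∀ c a x y z p → c * a * (x * y * z * p) ≡ a * ((c * (y * z)) * (x * p))
  regroup = solve-∀

choose-then-arrange : (m s′ t u : ℕ) → u ≤ t →
  ((m + u) C m) * arrangements m ((suc s′ * m + t) ∸ (m + u)) s′ * ((suc s′ * m + t) C (m + u))
    ≡ (t C u) * arrangements m (suc s′ * m + t) (suc s′)
choose-then-arrange m s′ t u u≤t = *-cancelʳ-≡ _ _ (denominator m s′ t u) {{denominator≢0}}
  (trans (choose-first-count m s′ t u u≤t) (sym (arrange-first-count m s′ t u u≤t)))
  where
  denominator≢0 : NonZero (denominator m s′ t u)
  denominator≢0 = m*n≢0 _ _ {{m*n≢0 _ _ {{m !* u !≢0}} {{(t ∸ u) !≢0}}}} {{m^n≢0 (m !) s′ {{m !≢0}}}}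

clear-denominators : {X c s y K B D f g N! : ℕ} → 1 ≤ c
  → X * c ≤ s * (y * K) → K * B ≡ c * D → D * (f * g) ≡ N!
  → B * X * f * g ≤ s * y * N!
clear-denominators {X} {c} {s} {y} {K} {B} {D} {f} {g} {N!} c>0 XcsyK KB≡cD Dfg≡N! =
  *-cancelˡ-≤ c {{>-nonZero c>0}} (begin
    c * (B * X * f * g)       ≡⟨ regroup₁ c B X f g ⟩
    X * c * (B * (f * g))     ≤⟨ *-monoˡ-≤ (B * (f * g)) XcsyK ⟩
    s * (y * K) * (B * (f * g)) ≡⟨ regroup₂ s y K B (f * g) ⟩
    s * y * (K * B) * (f * g) ≡⟨ cong (λ x → s * y * x * (f * g)) KB≡cD ⟩
    s * y * (c * D) * (f * g) ≡⟨ regroup₃ s y c D (f * g) ⟩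
    c * (s * y * (D * (f * g))) ≡⟨ cong (λ x → c * (s * y * x)) Dfg≡N! ⟩
    c * (s * y * N!)          ∎)
  where
  open ≤-Reasoning
  regroup₁ : ∀ c B X f g → c * (B * X * f * g) ≡ X * c * (B * (f * g))
  regroup₁ = solve-∀
  regroup₂ : ∀ s y K B h → s * (y * K) * (B * h) ≡ s * y * (K * B) * h
  regroup₂ = solve-∀
  regroup₃ : ∀ s y c D h → s * y * (c * D) * h ≡ c * (s * y * (D * h))
  regroup₃ = solve-∀

disjᵇ⇒Disjoint : (A B : Subset n) → disjᵇ A B ≡ true → Disjoint A B
disjᵇ⇒Disjoint (false ∷ A) (b ∷ B) h zero (() , _)
disjᵇ⇒Disjoint (true ∷ A) (false ∷ B) h zero (_ , ())
disjᵇ⇒Disjoint (a ∷ A) (b ∷ B) h (suc i) (there i∈A , there i∈B) =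
  disjᵇ⇒Disjoint A B (proj₂ (∧-split {not (a ∧ b)} h)) i (i∈A , i∈B)

pairwiseDisjᵇ⇒Disjoint : (T : Vec (Subset n) k) → pairwiseDisjᵇ T ≡ true
  → (i j : Fin k) → i ≢ j → Disjoint (lookup T i) (lookup T j)
pairwiseDisjᵇ⇒Disjoint (A ∷ T) h zero zero i≢j = ⊥-elim (i≢j refl)
pairwiseDisjᵇ⇒Disjoint (A ∷ T) h zero (suc j) _ =
  disjᵇ⇒Disjoint A (lookup T j) (allᵇ-lookup T (proj₁ (∧-split {allᵇ (disjᵇ A) T} h)) j)
pairwiseDisjᵇ⇒Disjoint (A ∷ T) h (suc i) zero _ =
  disjᵇ⇒Disjoint (lookup T i) A (disj-sym A (lookup T i) (allᵇ-lookup T (proj₁ (∧-split {allᵇ (disjᵇ A) T} h)) i))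
pairwiseDisjᵇ⇒Disjoint (A ∷ T) h (suc i) (suc j) i≢j =
  pairwiseDisjᵇ⇒Disjoint T (proj₂ (∧-split {allᵇ (disjᵇ A) T} h)) i j (i≢j ∘ cong suc)

uncovered : Vec (Subset n) k → Subset n
uncovered [] = full
uncovered (A ∷ T) = uncovered T ─ A

⊆-uncovered : (A : Subset n) (T : Vec (Subset n) k) → allᵇ (disjᵇ A) T ≡ true → A ⊆ᵇ uncovered T ≡ true
⊆-uncovered A [] _ = ⊆ᵇ-full A
⊆-uncovered A (A′ ∷ T) h =
  ⊆⇒⊆─ A (uncovered T) A′ (⊆-uncovered A T (allᵇ-tail {x = A′} T h)) (disj-sym A A′ (allᵇ-head {x = A′} T h))

uncovered-avoided : (T : Vec (Subset n) k) → allᵇ (λ A → disjᵇ A (uncovered T)) T ≡ true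
uncovered-avoided [] = refl
uncovered-avoided (A ∷ T) = ∧-intro (disj-─ A (uncovered T))
  (allᵇ-map (λ A′ h → disj-⊆ A′ (uncovered T) (uncovered T ─ A) h (─-⊆ᵇ (uncovered T) A)) T (uncovered-avoided T))

∣uncovered∣ : (m : ℕ) (T : Vec (Subset n) k) → Packings.packed m full T ≡ true → ∣ uncovered T ∣ ≡ n ∸ k * m
∣uncovered∣ {n} m [] _ = ∣⊤∣≡n n
∣uncovered∣ {n} {suc k} m (A ∷ T) h = begin
  ∣ uncovered T ─ A ∣          ≡⟨ ∣─chosen∣ (uncovered T) A (chosen-in full (uncovered T) A (Packings.packed-head m full A T h) A⊆uncovered) ⟩
  ∣ uncovered T ∣ ∸ m          ≡⟨ cong (_∸ m) (∣uncovered∣ m T (Packings.packed-drop m full A T h)) ⟩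
  n ∸ k * m ∸ m                ≡⟨ ∸-+-assoc n (k * m) m ⟩
  n ∸ (k * m + m)              ≡⟨ cong (n ∸_) (+-comm (k * m) m) ⟩
  n ∸ (m + k * m)              ∎
  where
  open ≡-Reasoning
  A⊆uncovered = ⊆-uncovered A T (proj₁ (∧-split {allᵇ (disjᵇ A) T} (proj₂ (∧-split {allᵇ (chosen full m) (A ∷ T)} h))))

traps-enlarged : (T : Vec (Subset n) k) (r : Fin k) (B : Subset n)
  → pairwiseDisjᵇ T ≡ true → B ⊆ᵇ uncovered T ≡ true → traps (lookup T r ∪ B) r T ≡ true
traps-enlarged (A ∷ T) zero B T-disj B⊆ = ∧-intro (⊆ᵇ-∪ A B)
  (allᵇ-zip (λ A′ A∩A′ B∩A′ → disj-∪ˡ A B A′ A∩A′ B∩A′) T (proj₁ (∧-split {allᵇ (disjᵇ A) T} T-disj))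
    (allᵇ-map (λ A′ A′∩uncovered → disj-sym A′ B (disj-⊆ A′ (uncovered T) B A′∩uncovered (⊆─⇒⊆ B (uncovered T) A B⊆)))
      T (uncovered-avoided T)))
traps-enlarged (A ∷ T) (suc r) B T-disj B⊆ = ∧-intro
  (disj-∪ˡ (lookup T r) B A (disj-sym A (lookup T r) (allᵇ-lookup T (proj₁ (∧-split {allᵇ (disjᵇ A) T} T-disj)) r))
                            (disj-sym A B (⊆─⇒disj B (uncovered T) A B⊆)))
  (traps-enlarged T r B (proj₂ (∧-split {allᵇ (disjᵇ A) T} T-disj)) (⊆─⇒⊆ B (uncovered T) A B⊆))

module Blocking {n : ℕ} (F : Family n) where

  ν< : ℕ → Set
  ν< k = ¬ Σ (Fin k → Subset n) (λ A → ((i : Fin k) → F (A i) ≡ true)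
           × ((i j : Fin k) → i ≢ j → Disjoint (A i) (A j)))

  data Completes : Subset n → Vec (Subset n) k → Vec (Subset n) k → Set where
    done : {Y : Subset n} → Completes Y [] []
    keep : {Y A : Subset n} {T T′ : Vec (Subset n) k}
      → F A ≡ true → Completes Y T T′ → Completes Y (A ∷ T) (A ∷ T′)
    grow : {Y A B : Subset n} {T T′ : Vec (Subset n) k}
      → B ⊆ᵇ Y ≡ true → F (A ∪ B) ≡ true → Completes (Y ─ B) T T′ → Completes Y (A ∷ T) ((A ∪ B) ∷ T′)

  Blocked : Subset n → Vec (Subset n) k → Set
  Blocked Y T = ∀ T′ → ¬ Completes Y T T′

  completes-in-F : {Y : Subset n} {T T′ : Vec (Subset n) k} → Completes Y T T′ → ∀ i → F (lookup T′ i) ≡ true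
  completes-in-F (keep A∈F _) zero = A∈F
  completes-in-F (grow _ A∪B∈F _) zero = A∪B∈F
  completes-in-F (keep _ c) (suc i) = completes-in-F c i
  completes-in-F (grow _ _ c) (suc i) = completes-in-F c i

  completes-avoid : {Y : Subset n} {T T′ : Vec (Subset n) k} → Completes Y T T′
    → (Z : Subset n) → disjᵇ Z Y ≡ true → allᵇ (disjᵇ Z) T ≡ true → allᵇ (disjᵇ Z) T′ ≡ true
  completes-avoid done Z _ _ = refl
  completes-avoid (keep {A = A} {T = T} _ c) Z Z∩Y h =
    ∧-intro (allᵇ-head {x = A} T h) (completes-avoid c Z Z∩Y (allᵇ-tail {x = A} T h))
  completes-avoid (grow {Y = Y} {A = A} {B = B} {T = T} B⊆Y _ c) Z Z∩Y h =
    ∧-intro (disj-∪ʳ Z A B (allᵇ-head {x = A} T h) (disj-⊆ Z Y B Z∩Y B⊆Y))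
            (completes-avoid c Z (disj-⊆ Z Y (Y ─ B) Z∩Y (─-⊆ᵇ Y B)) (allᵇ-tail {x = A} T h))

  completes-pairwise : {Y : Subset n} {T T′ : Vec (Subset n) k} → Completes Y T T′
    → pairwiseDisjᵇ T ≡ true → allᵇ (λ A → disjᵇ A Y) T ≡ true → pairwiseDisjᵇ T′ ≡ true
  completes-pairwise done _ _ = refl
  completes-pairwise (keep {A = A} {T = T} _ c) h avoid with ∧-split {allᵇ (disjᵇ A) T} h
  ... | A∩T , T-disj = ∧-intro (completes-avoid c A (allᵇ-head {x = A} T avoid) A∩T)
                               (completes-pairwise c T-disj (allᵇ-tail {x = A} T avoid))
  completes-pairwise (grow {Y = Y} {A = A} {B = B} {T = T} B⊆Y _ c) h avoid with ∧-split {allᵇ (disjᵇ A) T} h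
  ... | A∩T , T-disj = ∧-intro (completes-avoid c (A ∪ B) A∪B∩Y─B A∪B∩T)
                               (completes-pairwise c T-disj (allᵇ-map shrink T (allᵇ-tail {x = A} T avoid)))
    where
    A∩Y = allᵇ-head {x = A} T avoid
    A∪B∩Y─B = disj-∪ˡ A B (Y ─ B) (disj-⊆ A Y (Y ─ B) A∩Y (─-⊆ᵇ Y B)) (disj-─ B Y)
    A∪B∩T = allᵇ-zip (λ A′ A∩A′ A′∩Y → disj-∪ˡ A B A′ A∩A′ (disj-sym A′ B (disj-⊆ A′ Y B A′∩Y B⊆Y)))
              T A∩T (allᵇ-tail {x = A} T avoid)
    shrink : ∀ A′ → disjᵇ A′ Y ≡ true → disjᵇ A′ (Y ─ B) ≡ true
    shrink A′ A′∩Y = disj-⊆ A′ Y (Y ─ B) A′∩Y (─-⊆ᵇ Y B)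

  packing-blocked : ν< k → (T : Vec (Subset n) k) → pairwiseDisjᵇ T ≡ true → Blocked (uncovered T) T
  packing-blocked ν<k T T-disj T′ c =
    ν<k (lookup T′ , completes-in-F c , pairwiseDisjᵇ⇒Disjoint T′ (completes-pairwise c T-disj (uncovered-avoided T)))

  #out : Vec (Subset n) k → ℕ
  #out = countᵇ (λ A → not (F A))

  #out-∷ : (A : Subset n) (T : Vec (Subset n) k) → #out (A ∷ T) ≡ 𝟙 (not (F A)) + #out T
  #out-∷ A T with F A
  ... | true = refl
  ... | false = refl

  self-completes : (Y : Subset n) (T : Vec (Subset n) k) → #out T ≡ 0 → Completes Y T T
  self-completes Y [] _ = done
  self-completes Y (A ∷ T) none with F A in A∈F | #out-∷ A T
  ... | true | e = keep A∈F (self-completes Y T (trans (sym e) none))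
  ... | false | e = ⊥-elim (1+n≢0 (trans (sym e) none))

module Escapes {n : ℕ} (F : Family n) (u : ℕ) where
  open Blocking F

  escapes absorbed : Subset n → Subset n → ℕ
  escapes Y A = count (λ B → chosen Y u B ∧ not (F (A ∪ B))) (allSubsets n)
  absorbed Y A = count (λ B → chosen Y u B ∧ F (A ∪ B)) (allSubsets n)

  escapes-of : Subset n → Vec (Subset n) k → ℕ
  escapes-of {k} Y T = ∑[ r ← allFin k ] escapes Y (lookup T r)

  escapes+absorbed : (Y A : Subset n) → escapes Y A + absorbed Y A ≡ ∣ Y ∣ C u
  escapes+absorbed Y A = begin
    escapes Y A + absorbed Y A ≡⟨ sym (∑-+ (allSubsets n) _ _) ⟩
    ∑[ B ← allSubsets n ] (𝟙 (chosen Y u B ∧ not (F (A ∪ B))) + 𝟙 (chosen Y u B ∧ F (A ∪ B)))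
                               ≡⟨ ∑-cong (allSubsets n) (λ B → sym (𝟙-split (chosen Y u B) (F (A ∪ B)))) ⟩
    count (chosen Y u) (allSubsets n) ≡⟨ count-chosen Y u ⟩
    ∣ Y ∣ C u                  ∎
    where open ≡-Reasoning

  -- Double counting the pairs (B, B′) of disjoint u-subsets of Y with A ∪ B′ ∉ 𝓕:
  -- for each such B′ there are at most (∣ Y ∣ ∸ u) C u choices of B.
  escape-pairs : (Y A : Subset n)
    → ∑[ B ← allSubsets n ] (𝟙 (chosen Y u B) * escapes (Y ─ B) A) ≤ escapes Y A * ((∣ Y ∣ ∸ u) C u)
  escape-pairs Y A = begin
    ∑[ B ← 𝒫 ] (𝟙 (chosen Y u B) * escapes (Y ─ B) A)
      ≡⟨ ∑-cong 𝒫 (λ B → sym (∑-*ˡ 𝒫 (𝟙 (chosen Y u B)) (λ B′ → 𝟙 (escape (Y ─ B) B′)))) ⟩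
    ∑[ B ← 𝒫 ] ∑[ B′ ← 𝒫 ] (𝟙 (chosen Y u B) * 𝟙 (escape (Y ─ B) B′))
      ≡⟨ ∑-swap 𝒫 𝒫 _ ⟩
    ∑[ B′ ← 𝒫 ] ∑[ B ← 𝒫 ] (𝟙 (chosen Y u B) * 𝟙 (escape (Y ─ B) B′))
      ≤⟨ ∑-mono 𝒫 partners ⟩
    ∑[ B′ ← 𝒫 ] (𝟙 (escape Y B′) * c)
      ≡⟨ ∑-*ʳ 𝒫 c (λ B′ → 𝟙 (escape Y B′)) ⟩
    escapes Y A * c ∎
    where
    open ≤-Reasoning
    𝒫 = allSubsets n
    c = (∣ Y ∣ ∸ u) C u
    escape : Subset n → Subset n → Bool
    escape Y′ B′ = chosen Y′ u B′ ∧ not (F (A ∪ B′))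
    -- B′ ⊆ Y − B with B ⊆ Y forces B ⊆ Y − B′.
    swap-sides : ∀ B B′ → (chosen Y u B ∧ escape (Y ─ B) B′) ≡ true → chosen (Y ─ B′) u B ≡ true
    swap-sides B B′ h with ∧-split {chosen Y u B} h
    ... | B-in-Y , B′-esc with chosen-⊆ (Y ─ B) B′ (proj₁ (∧-split {chosen (Y ─ B) u B′} B′-esc))
    ... | B′⊆Y─B = chosen-in Y (Y ─ B′) B B-in-Y
                     (⊆⇒⊆─ B Y B′ (chosen-⊆ Y B B-in-Y) (disj-sym B B′ (⊆─⇒disj B′ Y B B′⊆Y─B)))
    escapes-in-Y : ∀ B B′ → (chosen Y u B ∧ escape (Y ─ B) B′) ≡ true → escape Y B′ ≡ true
    escapes-in-Y B B′ h with ∧-split {chosen Y u B} h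
    ... | _ , B′-esc with ∧-split {chosen (Y ─ B) u B′} B′-esc
    ... | B′-in , B′∉F = ∧-intro (chosen-in (Y ─ B) Y B′ B′-in (⊆─⇒⊆ B′ Y B (chosen-⊆ (Y ─ B) B′ B′-in))) B′∉F
    partners : ∀ B′ → ∑[ B ← 𝒫 ] (𝟙 (chosen Y u B) * 𝟙 (escape (Y ─ B) B′)) ≤ 𝟙 (escape Y B′) * c
    partners B′ = ≤-𝟙* (escape Y B′)
      (λ esc → begin
        ∑[ B ← 𝒫 ] (𝟙 (chosen Y u B) * 𝟙 (escape (Y ─ B) B′))
          ≤⟨ ∑-mono 𝒫 (λ B → subst (_≤ _) (𝟙-∧ (chosen Y u B) _) (𝟙-mono (swap-sides B B′))) ⟩
        count (chosen (Y ─ B′) u) 𝒫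
          ≡⟨ count-chosen (Y ─ B′) u ⟩
        ∣ Y ─ B′ ∣ C u
          ≡⟨ cong (_C u) (∣─chosen∣ Y B′ (proj₁ (∧-split {chosen Y u B′} esc))) ⟩
        c ∎)
      (λ ¬esc → ∑-zero 𝒫 (λ B → trans (sym (𝟙-∧ (chosen Y u B) _))
                   (𝟙-false (λ h → clash (escapes-in-Y B B′ h) ¬esc))))

  absorbed-bound : (Y A : Subset n) (T : Vec (Subset n) k)
    → (∀ B → (chosen Y u B ∧ F (A ∪ B)) ≡ true → (∣ Y ∣ ∸ u) C u ≤ escapes-of (Y ─ B) T)
    → absorbed Y A * ((∣ Y ∣ ∸ u) C u) ≤ escapes-of Y T * ((∣ Y ∣ ∸ u) C u)
  absorbed-bound {k} Y A T enough = begin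
    absorbed Y A * c
      ≡⟨ sym (∑-*ʳ 𝒫 c (λ B → 𝟙 (chosen Y u B ∧ F (A ∪ B)))) ⟩
    ∑[ B ← 𝒫 ] (𝟙 (chosen Y u B ∧ F (A ∪ B)) * c)
      ≤⟨ ∑-mono 𝒫 use-enough ⟩
    ∑[ B ← 𝒫 ] (𝟙 (chosen Y u B) * escapes-of (Y ─ B) T)
      ≡⟨ ∑-cong 𝒫 (λ B → sym (∑-*ˡ (allFin k) (𝟙 (chosen Y u B)) (λ r → escapes (Y ─ B) (lookup T r)))) ⟩
    ∑[ B ← 𝒫 ] ∑[ r ← allFin k ] (𝟙 (chosen Y u B) * escapes (Y ─ B) (lookup T r))
      ≡⟨ ∑-swap 𝒫 (allFin k) _ ⟩
    ∑[ r ← allFin k ] ∑[ B ← 𝒫 ] (𝟙 (chosen Y u B) * escapes (Y ─ B) (lookup T r))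
      ≤⟨ ∑-mono (allFin k) (λ r → escape-pairs Y (lookup T r)) ⟩
    ∑[ r ← allFin k ] (escapes Y (lookup T r) * c)
      ≡⟨ ∑-*ʳ (allFin k) c (λ r → escapes Y (lookup T r)) ⟩
    escapes-of Y T * c ∎
    where
    open ≤-Reasoning
    𝒫 = allSubsets n
    c = (∣ Y ∣ ∸ u) C u
    use-enough : ∀ B → 𝟙 (chosen Y u B ∧ F (A ∪ B)) * c ≤ 𝟙 (chosen Y u B) * escapes-of (Y ─ B) T
    use-enough B with chosen Y u B ∧ F (A ∪ B) in absorbs
    ... | false = z≤n
    ... | true rewrite proj₁ (∧-split {chosen Y u B} absorbs) = +-monoˡ-≤ 0 (enough B absorbs)

  -- Suppose every u-subset B of Y absorbed by A leaves T blocked in Y − B and, inductively,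
  -- with (∣ Y ∣ ∸ u) C u escapes inside Y − B.  If some entry of T lies outside 𝓕 this binomial
  -- is positive and absorbed-bound can be cancelled; otherwise T itself would complete, so
  -- nothing is absorbed.
  absorbed≤escapes : (Y A : Subset n) (T : Vec (Subset n) k) → u + #out T * u ≤ ∣ Y ∣
    → (∀ B → (chosen Y u B ∧ F (A ∪ B)) ≡ true → Blocked (Y ─ B) T)
    → (∀ B → (chosen Y u B ∧ F (A ∪ B)) ≡ true → (∣ Y ∣ ∸ u) C u ≤ escapes-of (Y ─ B) T)
    → absorbed Y A ≤ escapes-of Y T
  absorbed≤escapes Y A T room blocked-rest enough with #out T in #outT
  ... | zero = ≤-trans (≤-reflexive nothing-absorbed) z≤n
    where
    nothing-absorbed : absorbed Y A ≡ 0
    nothing-absorbed = ∑-zero (allSubsets n) (λ B → 𝟙-false (λ absorbs →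
      blocked-rest B absorbs T (self-completes (Y ─ B) T #outT)))
  ... | suc j = *-cancelʳ-≤ (absorbed Y A) (escapes-of Y T) ((∣ Y ∣ ∸ u) C u) {{>-nonZero (C-positive u≤rest)}}
                  (absorbed-bound Y A T enough)
    where
    u≤rest : u ≤ ∣ Y ∣ ∸ u
    u≤rest = m+n≤o⇒m≤o∸n u (≤-trans (+-monoʳ-≤ u (m≤m+n u (j * u))) room)

  claim : (T : Vec (Subset n) k) (Y : Subset n) → Blocked Y T → #out T * u ≤ ∣ Y ∣
    → ∣ Y ∣ C u ≤ escapes-of Y T
  claim [] Y blocked _ = ⊥-elim (blocked [] done)
  claim {suc k} (A ∷ T) Y blocked room with F A in A∈F | #out-∷ A T
  ... | true | #out≡ = begin
    ∣ Y ∣ C u                                 ≤⟨ claim T Y (λ T′ c → blocked (A ∷ T′) (keep A∈F c)) room′ ⟩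
    escapes-of Y T                            ≤⟨ m≤n+m _ (escapes Y A) ⟩
    escapes Y A + escapes-of Y T              ≡⟨ sym (∑-allFin-suc {k} (λ r → escapes Y (lookup (A ∷ T) r))) ⟩
    escapes-of Y (A ∷ T)                      ∎
    where
    open ≤-Reasoning
    room′ = subst (λ x → x * u ≤ ∣ Y ∣) #out≡ room
  ... | false | #out≡ = begin
    ∣ Y ∣ C u                                 ≡⟨ sym (escapes+absorbed Y A) ⟩
    escapes Y A + absorbed Y A                ≤⟨ +-monoʳ-≤ (escapes Y A) (absorbed≤escapes Y A T room′ blocked-rest induction) ⟩
    escapes Y A + escapes-of Y T              ≡⟨ sym (∑-allFin-suc {k} (λ r → escapes Y (lookup (A ∷ T) r))) ⟩
    escapes-of Y (A ∷ T)                      ∎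
    where
    open ≤-Reasoning
    room′ : u + #out T * u ≤ ∣ Y ∣
    room′ = subst (λ x → x * u ≤ ∣ Y ∣) #out≡ room
    blocked-rest : ∀ B → (chosen Y u B ∧ F (A ∪ B)) ≡ true → Blocked (Y ─ B) T
    blocked-rest B absorbs T′ c with ∧-split {chosen Y u B} absorbs
    ... | B-in-Y , A∪B∈F = blocked ((A ∪ B) ∷ T′) (grow (chosen-⊆ Y B B-in-Y) A∪B∈F c)
    induction : ∀ B → (chosen Y u B ∧ F (A ∪ B)) ≡ true → (∣ Y ∣ ∸ u) C u ≤ escapes-of (Y ─ B) T
    induction B absorbs = subst (λ y → y C u ≤ escapes-of (Y ─ B) T) ∣Y─B∣
      (claim T (Y ─ B) (blocked-rest B absorbs)
        (subst (#out T * u ≤_) (sym ∣Y─B∣) (m+n≤o⇒m≤o∸n (#out T * u) (subst (_≤ ∣ Y ∣) (+-comm u _) room′))))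
      where ∣Y─B∣ = ∣─chosen∣ Y B (proj₁ (∧-split {chosen Y u B} absorbs))

module Counting {n : ℕ} (F : Family n) (m u : ℕ) where
  open Blocking F
  open Escapes F u
  open Packings m

  packing : Vec (Subset n) k → Bool
  packing T = allᵇ (λ A → ∣ A ∣ ≡ᵇ m) T ∧ pairwiseDisjᵇ T

  packing⇒packed : (T : Vec (Subset n) k) → packing T ≡ true → packed full T ≡ true
  packing⇒packed T h with ∧-split {allᵇ (λ A → ∣ A ∣ ≡ᵇ m) T} h
  ... | sizes , T-disj = ∧-intro (allᵇ-map (λ A size → ∧-intro (⊆ᵇ-full A) size) T sizes) T-disj

  outside : Subset n → Bool
  outside Z = (∣ Z ∣ ≡ᵇ (m + u)) ∧ not (F Z)

  -- Enlarging the r-th entry A of a packing by an escaping u-set B of uncovered points yields an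
  -- (m + u)-set A ∪ B outside 𝓕 that traps the r-th entry; B is recovered as (A ∪ B) − A.
  enlarge : (T : Vec (Subset n) k) (r : Fin k) (B : Subset n)
    → (packing T ∧ (chosen (uncovered T) u B ∧ not (F (lookup T r ∪ B)))) ≡ true
    → (outside (lookup T r ∪ B) ∧ (packed full T ∧ traps (lookup T r ∪ B) r T)) ≡ true
      × ((lookup T r ∪ B) ─ lookup T r ≡ B)
  enlarge T r B h with ∧-split {packing T} h
  ... | T-packing , B-escapes with ∧-split {chosen (uncovered T) u B} B-escapes
  ... | B-in , Aᵣ∪B∉F =
    ∧-intro (∧-intro size Aᵣ∪B∉F) (∧-intro (packing⇒packed T T-packing) (traps-enlarged T r B T-disj B⊆))
    , ∪-─ Aᵣ B Aᵣ∩B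
    where
    Aᵣ = lookup T r
    T-disj = proj₂ (∧-split {allᵇ (λ X → ∣ X ∣ ≡ᵇ m) T} T-packing)
    B⊆ = chosen-⊆ (uncovered T) B B-in
    Aᵣ∩B = disj-⊆ Aᵣ (uncovered T) B (allᵇ-lookup T (uncovered-avoided T) r) B⊆
    ∣Aᵣ∣ = ≡ᵇ-sound (allᵇ-lookup T (proj₁ (∧-split {allᵇ (λ X → ∣ X ∣ ≡ᵇ m) T} T-packing)) r)
    size : (∣ Aᵣ ∪ B ∣ ≡ᵇ (m + u)) ≡ true
    size = subst (λ x → (x ≡ᵇ (m + u)) ≡ true)
             (sym (trans (∣∪∣ Aᵣ B Aᵣ∩B) (cong₂ _+_ ∣Aᵣ∣ (chosen-size (uncovered T) B B-in)))) (≡ᵇ-refl (m + u))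

  -- For each position r, the escapes of the r-th entries over all packings inject into the pairs
  -- (Z, T) with Z an (m + u)-set outside 𝓕 trapping the r-th entry of T; count-traps bounds these.
  escape-count : (s′ : ℕ) (r : Fin (suc s′))
    → ∑[ T ← tuples (suc s′) n ] (𝟙 (packing T) * escapes (uncovered T) (lookup T r))
      ≤ count outside (allSubsets n) * (((m + u) C m) * arrangements m (n ∸ (m + u)) s′)
  escape-count s′ r = begin
    ∑[ T ← 𝒯 ] (𝟙 (packing T) * escapes (uncovered T) (lookup T r))
      ≡⟨ ∑-cong 𝒯 (λ T → trans (sym (∑-*ˡ 𝒫 (𝟙 (packing T)) _)) (∑-cong 𝒫 (λ B → sym (𝟙-∧ (packing T) _)))) ⟩
    ∑[ T ← 𝒯 ] count (λ B → packing T ∧ (chosen (uncovered T) u B ∧ not (F (lookup T r ∪ B)))) 𝒫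
      ≤⟨ ∑-mono 𝒯 (λ T → count-injection _ _ (lookup T r ∪_) (_─ lookup T r) (enlarge T r)) ⟩
    ∑[ T ← 𝒯 ] count (λ Z → outside Z ∧ (packed full T ∧ traps Z r T)) 𝒫
      ≡⟨ ∑-cong 𝒯 (λ T → ∑-cong 𝒫 (λ Z → 𝟙-∧ (outside Z) _)) ⟩
    ∑[ T ← 𝒯 ] ∑[ Z ← 𝒫 ] (𝟙 (outside Z) * 𝟙 (packed full T ∧ traps Z r T))
      ≡⟨ ∑-swap 𝒯 𝒫 _ ⟩
    ∑[ Z ← 𝒫 ] ∑[ T ← 𝒯 ] (𝟙 (outside Z) * 𝟙 (packed full T ∧ traps Z r T))
      ≡⟨ ∑-cong 𝒫 (λ Z → ∑-*ˡ 𝒯 (𝟙 (outside Z)) _) ⟩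
    ∑[ Z ← 𝒫 ] (𝟙 (outside Z) * count (λ T → packed full T ∧ traps Z r T) 𝒯)
      ≤⟨ ∑-mono 𝒫 trapped ⟩
    ∑[ Z ← 𝒫 ] (𝟙 (outside Z) * K)
      ≡⟨ ∑-*ʳ 𝒫 K (𝟙 ∘ outside) ⟩
    count outside 𝒫 * K ∎
    where
    open ≤-Reasoning
    𝒫 = allSubsets n
    𝒯 = tuples (suc s′) n
    K = ((m + u) C m) * arrangements m (n ∸ (m + u)) s′
    trapped : ∀ Z → 𝟙 (outside Z) * count (λ T → packed full T ∧ traps Z r T) 𝒯 ≤ 𝟙 (outside Z) * K
    trapped Z with outside Z in Z-outside
    ... | false = z≤n
    ... | true = +-monoˡ-≤ 0 (subst₂ (λ z N → count (λ T → packed full T ∧ traps Z r T) 𝒯 ≤ (z C m) * arrangements m (N ∸ z) s′) ∣Z∣ (∣⊤∣≡n n)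
                   (count-traps s′ r full Z (⊆ᵇ-full Z)))
      where ∣Z∣ = ≡ᵇ-sound (proj₁ (∧-split {∣ Z ∣ ≡ᵇ (m + u)} Z-outside))

  -- Σ_{i=1}^{k} cntX F s m i counts the packings with 1 ≤ #out T ≤ k; if each of them has
  -- weight w T ≥ c, then this count times c is at most the total weight of all packings.
  layered-count : (s k c : ℕ) (w : Vec (Subset n) s → ℕ)
    → (∀ T → packing T ≡ true → 1 ≤ #out T → #out T ≤ k → c ≤ w T)
    → Σ₁ k (λ i → cntX F s m i) * c ≤ ∑[ T ← tuples s n ] (𝟙 (packing T) * w T)
  layered-count s k c w heavy = begin
    sum (applyUpTo (λ i → cntX F s m (suc i)) k) * c
      ≡⟨ cong (_* c) (∑<-cong k (λ i → length-filterᵇ (layer (suc i)) 𝒯)) ⟩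
    sum (applyUpTo (λ i → count (layer (suc i)) 𝒯) k) * c
      ≡⟨ cong (_* c) (∑<-swap k 𝒯 (λ i T → 𝟙 (layer (suc i) T))) ⟩
    ∑[ T ← 𝒯 ] sum (applyUpTo (λ i → 𝟙 (layer (suc i) T)) k) * c
      ≡⟨ sym (∑-*ʳ 𝒯 c _) ⟩
    ∑[ T ← 𝒯 ] (sum (applyUpTo (λ i → 𝟙 (layer (suc i) T)) k) * c)
      ≡⟨ ∑-cong 𝒯 (λ T → sym (∑<-*ʳ k (λ i → 𝟙 (layer (suc i) T)) c)) ⟩
    ∑[ T ← 𝒯 ] sum (applyUpTo (λ i → 𝟙 (layer (suc i) T) * c) k)
      ≤⟨ ∑-mono 𝒯 (λ T → subst (_≤ 𝟙 (packing T) * w T) (∑<-cong k (λ i → cong (λ b → 𝟙 b * c) (regroup T i)))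
                                (per-packing T (packing T) refl)) ⟩
    ∑[ T ← 𝒯 ] (𝟙 (packing T) * w T) ∎
    where
    open ≤-Reasoning
    𝒯 = tuples s n
    layer : ℕ → Vec (Subset n) s → Bool
    layer i T = allᵇ (λ A → ∣ A ∣ ≡ᵇ m) T ∧ pairwiseDisjᵇ T ∧ (#out T ≡ᵇ i)
    regroup : ∀ T i → packing T ∧ (#out T ≡ᵇ suc i) ≡ layer (suc i) T
    regroup T i = ∧-assoc (allᵇ (λ A → ∣ A ∣ ≡ᵇ m) T) (pairwiseDisjᵇ T) (#out T ≡ᵇ suc i)
    per-packing : ∀ T b → packing T ≡ b → sum (applyUpTo (λ i → 𝟙 (b ∧ (#out T ≡ᵇ suc i)) * c) k) ≤ 𝟙 b * w T
    per-packing T true is-packing = ∑<-indicator k (#out T) c (1 * w T)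
      (λ 1≤out out≤k → subst (c ≤_) (sym (+-identityʳ (w T))) (heavy T is-packing 1≤out out≤k))
    per-packing T false _ = ≤-reflexive (∑<-zero k (λ _ → refl))

  -- The core double counting: each packing T with 1 ≤ #out T ≤ ⌊t/u⌋ has at least t C u escapes
  -- from its t uncovered points (claim), while the escapes at each of the s positions number at
  -- most y(m + u) · K (escape-count).
  escape-inequality : (s′ t : ℕ) .{{_ : NonZero u}} → ν< (suc s′) → n ∸ suc s′ * m ≡ t
    → Σ₁ (t / u) (λ i → cntX F (suc s′) m i) * (t C u)
      ≤ suc s′ * (y F (m + u) * (((m + u) C m) * arrangements m (n ∸ (m + u)) s′))
  escape-inequality s′ t ν<s uncovered≡t = begin
    Σ₁ (t / u) (λ i → cntX F s m i) * (t C u)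
      ≤⟨ layered-count s (t / u) (t C u) (λ T → escapes-of (uncovered T) T) blocked-escapes ⟩
    ∑[ T ← 𝒯 ] (𝟙 (packing T) * escapes-of (uncovered T) T)
      ≡⟨ ∑-cong 𝒯 (λ T → sym (∑-*ˡ (allFin s) (𝟙 (packing T)) _)) ⟩
    ∑[ T ← 𝒯 ] ∑[ r ← allFin s ] (𝟙 (packing T) * escapes (uncovered T) (lookup T r))
      ≡⟨ ∑-swap 𝒯 (allFin s) _ ⟩
    ∑[ r ← allFin s ] ∑[ T ← 𝒯 ] (𝟙 (packing T) * escapes (uncovered T) (lookup T r))
      ≤⟨ ∑-mono (allFin s) (escape-count s′) ⟩
    ∑[ r ← allFin s ] (count outside (allSubsets n) * K)
      ≡⟨ ∑-allFin-const s _ ⟩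
    s * (count outside (allSubsets n) * K)
      ≡⟨ cong (λ x → s * (x * K)) (sym (length-filterᵇ outside (allSubsets n))) ⟩
    s * (y F (m + u) * K) ∎
    where
    open ≤-Reasoning
    s = suc s′
    𝒯 = tuples s n
    K = ((m + u) C m) * arrangements m (n ∸ (m + u)) s′
    blocked-escapes : ∀ T → packing T ≡ true → 1 ≤ #out T → #out T ≤ t / u → t C u ≤ escapes-of (uncovered T) T
    blocked-escapes T is-packing _ out≤ = subst (λ x → x C u ≤ escapes-of (uncovered T) T) ∣uncovered∣≡t
      (claim T (uncovered T) (packing-blocked ν<s T (proj₂ (∧-split {allᵇ (λ A → ∣ A ∣ ≡ᵇ m) T} is-packing)))
        (subst (#out T * u ≤_) (sym ∣uncovered∣≡t) (≤-trans (*-monoˡ-≤ u out≤) (m/n*n≤m t u))))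
      where
      ∣uncovered∣≡t : ∣ uncovered T ∣ ≡ t
      ∣uncovered∣≡t = trans (∣uncovered∣ m T (packing⇒packed T is-packing)) uncovered≡t

lemma2 : (s m l n : ℕ) → 2 ≤ s → 1 ≤ m → 1 ≤ l → l ≤ s
    → n ≡ s * m + (s ∸ l)
    → (F : Family n)
    → ¬ Σ (Fin s → Subset n) (λ A → ((i : Fin s) → F (A i) ≡ true)
          × ((i j : Fin s) → i ≢ j → Disjoint (A i) (A j)))
    → (u : ℕ) → (hu : 1 ≤ u) → u ≤ s ∸ l
    → s * y F (m + u) * (n !)
      ≥ (n C (m + u)) * Σ₁ (_/_ (s ∸ l) u {{>-nonZero hu}}) (λ i → cntX F s m i)
          * ((n ∸ s * m) !) * ((m !) ^ s)
lemma2 (suc s′) m l _ _ _ _ _ refl F ν<s u 1≤u u≤t =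
  clear-denominators {s = s} {y = y F (m + u)} {K = ((m + u) C m) * arrangements m (N ∸ (m + u)) s′}
                     {B = N C (m + u)} {D = arrangements m N s} {f = (N ∸ s * m) !} {g = (m !) ^ s}
    (C-positive u≤t)
    (Counting.escape-inequality F m u s′ t {{>-nonZero 1≤u}} ν<s (m+n∸m≡n (s * m) t))
    (choose-then-arrange m s′ t u u≤t)
    (arrangements-factorial m N s (m≤m+n (s * m) t))
  where
  s = suc s′
  t = s ∸ l
  N = s * m + t
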